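{- Let $\lambda\in\mathbb{C}$ with $\lambda\neq 1$, and let $a,n\in\mathbb{N}=\{1,2,3,\dots\}$. Then \[ H_{n-1}^{(n)}(x\mid\lambda)=\frac{1}{(1-\lambda)^{(a-1)n}}\sum_{l=0}^{(a-1)n}\binom{(a-1)n}{l}(-\lambda)^{(a-1)n-l}\,H_{n-1}^{(an)}(x+l\mid\lambda). \]
   Context: For $\lambda\in\mathbb{C}$, $\lambda\neq1$, and $\alpha\in\mathbb{R}$, the Frobenius–Euler polynomials of order $\alpha$ are defined by the generating function $\left(\frac{1-\lambda}{e^t-\lambda}\right)^{\alpha}e^{xt}=\sum_{n=0}^{\infty}H_n^{(\alpha)}(x\mid\lambda)\frac{t^n}{n!}$. The convention $0^0=1$ is used. -}

module Defs where

open import Level using (Level; _⊔_) renaming (suc to lsuc)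
open import Algebra.Bundles using (CommutativeRing)
open import Data.Nat as ℕ using (ℕ; zero; suc; _!)
open import Data.Fin using (Fin)
import Data.Fin as Fin
open import Data.Vec using (Vec; []; _∷_; lookup; head)
open import Relation.Nullary using (¬_)

natToRing : {c ℓ : Level} (R : CommutativeRing c ℓ) → ℕ → CommutativeRing.Carrier R
natToRing R zero    = CommutativeRing.0# R
natToRing R (suc n) = CommutativeRing._+_ R (CommutativeRing.1# R) (natToRing R n)

-- Agda's standard library has
-- no complex numbers and no Field bundle, so we work over an arbitrary
-- field of characteristic 0, given as a commutative ring with a
-- multiplicative inverse of every nonzero element.
record Char0Field (c ℓ : Level) : Set (lsuc (c ⊔ ℓ)) where
  field
    commRing : CommutativeRing c ℓ
  open CommutativeRing commRing public
  field
    _⁻¹      : Carrier → Carrier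
    inverse  : ∀ x → ¬ (x ≈ 0#) → (x * (x ⁻¹)) ≈ 1#
    1≉0      : ¬ (1# ≈ 0#)
    char0    : ∀ n → ¬ (natToRing commRing (suc n) ≈ 0#)

-- Frobenius–Euler polynomials of natural order, defined through their
-- generating function, computed in the ring of formal power series
-- (series are coefficient sequences ℕ → K, in the ordinary, not
-- exponential, normalisation).
module FrobeniusEuler {c ℓ : Level} (F : Char0Field c ℓ) where
  open Char0Field F using (Carrier; _+_; _*_; -_; _-_; 0#; 1#; _⁻¹; commRing)

  fromℕ : ℕ → Carrier
  fromℕ = natToRing commRing

  _^_ : Carrier → ℕ → Carrier
  x ^ zero  = 1#
  x ^ suc n = x * (x ^ n)

  sumℕ : ℕ → (ℕ → Carrier) → Carrier
  sumℕ zero    f = 0#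
  sumℕ (suc n) f = sumℕ n f + f n

  sumFin : (n : ℕ) → (Fin n → Carrier) → Carrier
  sumFin zero    f = 0#
  sumFin (suc n) f = f Fin.zero + sumFin n (λ i → f (Fin.suc i))

  Series : Set c
  Series = ℕ → Carrier

  _⊛_ : Series → Series → Series
  (f ⊛ g) n = sumℕ (suc n) (λ i → f i * g (n ℕ.∸ i))

  oneS : Series
  oneS zero    = 1#
  oneS (suc n) = 0#

  scale : Carrier → Series → Series
  scale a f n = a * f n

  powS : Series → ℕ → Series
  powS f zero    = oneS
  powS f (suc k) = f ⊛ powS f k

  -- multiplicative inverse of a series f with invertible constant term:
  -- g 0 = (f 0)⁻¹,  g m = -(f 0)⁻¹ Σ_{i=1}^{m} f i g (m-i).
  -- invPrefix f n = (g n , g (n-1) , … , g 0)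
  invPrefix : Series → (n : ℕ) → Vec Carrier (suc n)
  invPrefix f zero    = (f 0 ⁻¹) ∷ []
  invPrefix f (suc n) =
    (- (f 0 ⁻¹) * sumFin (suc n) (λ j → f (suc (Fin.toℕ j)) * lookup gs j)) ∷ gs
    where gs = invPrefix f n

  invS : Series → Series
  invS f n = head (invPrefix f n)

  expS : Carrier → Series
  expS x n = (x ^ n) * (fromℕ (n !) ⁻¹)

  expMinus : Carrier → Series
  expMinus λ' zero    = expS 1# zero - λ'
  expMinus λ' (suc n) = expS 1# (suc n)

  FEgen : ℕ → Carrier → Carrier → Series
  FEgen k λ' x = powS (scale (1# - λ') (invS (expMinus λ'))) k ⊛ expS x

  -- H_n^{(k)}(x | λ) = n! · [t^n] ((1-λ)/(e^t-λ))^k e^{xt}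
  H : ℕ → ℕ → Carrier → Carrier → Carrier
  H n k x λ' = fromℕ (n !) * FEgen k λ' x n

-- Put P = (1-λ)/(e^t-λ) and m = (a-1)n, so that an = n + m.  The binomial
-- theorem and e^{xt} e^{lt} = e^{(x+l)t} give
--     Σ_{l≤m} C(m,l) (-λ)^{m-l} e^{(x+l)t} = e^{xt} (e^t-λ)^m ,
-- and since P (e^t-λ) = 1-λ, multiplying by P^{n+m} yields
--     Σ_{l≤m} C(m,l) (-λ)^{m-l} P^{n+m} e^{(x+l)t} = (1-λ)^m P^n e^{xt} .
-- Comparing the coefficients of t^N gives, for all N, n and m,
--     Σ_{l≤m} C(m,l) (-λ)^{m-l} H_N^{(n+m)}(x+l) = (1-λ)^m H_N^{(n)}(x) ,
-- and the theorem is the case N = n-1, divided by (1-λ)^m ≠ 0.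

module Submission where

open import Defs
open import Level using (Level)
open import Data.Nat using (ℕ; suc; _*_; _∸_; _≤_)
open import Data.Nat.Combinatorics using (_C_)
open import Relation.Nullary using (¬_)

open import Data.Nat as ℕ using (zero; _!; NonZero)
import Data.Nat.Properties as ℕP
open import Data.Nat.DivMod using (m/n*n≡m)
open import Data.Nat.Combinatorics using (nCk≡n!/k![n-k]!; k![n∸k]!∣n!)
open import Data.Fin using (Fin; toℕ)
import Data.Fin as Fin
open import Data.Vec using (lookup)
open import Data.Product using (_,_)
open import Relation.Binary.PropositionalEquality as Eq using (_≡_)
open import Algebra.Bundles using (CommutativeSemiring)
open import Relation.Binary.Structures using (IsEquivalence)
import Algebra.Properties.CommutativeSemigroup as CommSemigroupProperties
import Algebra.Properties.CommutativeSemiring.Binomial as Binomial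
import Algebra.Properties.CommutativeSemiring.Exp as CommExp
import Algebra.Properties.Semiring.Exp as Exp
import Algebra.Properties.Semiring.Mult as Mult
import Algebra.Properties.Semiring.Sum as Sum
import Algebra.Structures
import Algebra.Structures.Biased
import Relation.Binary.Reasoning.Setoid as SetoidReasoning

binomial-factorials : ∀ {n i} → i ≤ n → (n C i) * (i ! * (n ∸ i) !) ≡ n !
binomial-factorials {n} {i} i≤n =
  Eq.trans (Eq.cong (_* (i ! * (n ∸ i) !)) (nCk≡n!/k![n-k]! i≤n))
          (m/n*n≡m {{i ℕP.!* (n ∸ i) !≢0}} (k![n∸k]!∣n! i≤n))

module Proof {c ℓ : Level} (F : Char0Field c ℓ) where
  open Char0Field F renaming (_*_ to _·_)
  open FrobeniusEuler F
  open SetoidReasoning setoid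
  open import Algebra.Properties.Ring ring using (-‿distribˡ-*; -‿distribʳ-*)
  module Add = CommSemigroupProperties +-commutativeSemigroup
  module Mul = CommSemigroupProperties *-commutativeSemigroup

  -- (1) Finite sums, natural numbers and inverses in K

  sumℕ-cong< : ∀ n {f g : ℕ → Carrier} → (∀ i → i ℕ.< n → f i ≈ g i) →
               sumℕ n f ≈ sumℕ n g
  sumℕ-cong< zero    eq = refl
  sumℕ-cong< (suc n) eq =
    +-cong (sumℕ-cong< n (λ i i<n → eq i (ℕP.m<n⇒m<1+n i<n))) (eq n (ℕP.n<1+n n))

  sumℕ-cong : ∀ n {f g : ℕ → Carrier} → (∀ i → f i ≈ g i) → sumℕ n f ≈ sumℕ n g
  sumℕ-cong n eq = sumℕ-cong< n (λ i _ → eq i)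

  sumℕ-uncons : ∀ n (f : ℕ → Carrier) → sumℕ (suc n) f ≈ f 0 + sumℕ n (λ i → f (suc i))
  sumℕ-uncons zero    f = trans (+-identityˡ _) (sym (+-identityʳ _))
  sumℕ-uncons (suc n) f = trans (+-cong (sumℕ-uncons n f) refl) (+-assoc _ _ _)

  sumℕ-distribˡ : ∀ n a (f : ℕ → Carrier) → a · sumℕ n f ≈ sumℕ n (λ i → a · f i)
  sumℕ-distribˡ zero    a f = zeroʳ a
  sumℕ-distribˡ (suc n) a f = trans (distribˡ _ _ _) (+-cong (sumℕ-distribˡ n a f) refl)

  sumFin≈sumℕ : ∀ n (f : ℕ → Carrier) → sumFin n (λ j → f (toℕ j)) ≈ sumℕ n f
  sumFin≈sumℕ zero    f = refl
  sumFin≈sumℕ (suc n) f =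
    trans (+-cong refl (sumFin≈sumℕ n (λ i → f (suc i)))) (sym (sumℕ-uncons n f))

  sumFin-cong : ∀ n {f g : Fin n → Carrier} → (∀ i → f i ≈ g i) → sumFin n f ≈ sumFin n g
  sumFin-cong zero    eq = refl
  sumFin-cong (suc n) eq = +-cong (eq Fin.zero) (sumFin-cong n (λ i → eq (Fin.suc i)))

  module MulK = Mult semiring

  fromℕ≡× : ∀ n → fromℕ n ≡ n MulK.× 1#
  fromℕ≡× zero    = Eq.refl
  fromℕ≡× (suc n) = Eq.cong (1# +_) (fromℕ≡× n)

  fromℕ-* : ∀ a b → fromℕ (a * b) ≈ fromℕ a · fromℕ b
  fromℕ-* a b
    rewrite fromℕ≡× (a * b) | fromℕ≡× a | fromℕ≡× b = MulK.×1-homo-* a b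

  ×≈fromℕ· : ∀ n x → n MulK.× x ≈ fromℕ n · x
  ×≈fromℕ· n x = begin
    n MulK.× x          ≈⟨ MulK.×-congʳ n (*-identityˡ x) ⟨
    n MulK.× (1# · x)   ≈⟨ MulK.×-assoc-* n 1# x ⟨
    (n MulK.× 1#) · x   ≡⟨ Eq.cong (_· x) (fromℕ≡× n) ⟨
    fromℕ n · x         ∎

  fromℕ-nonzero : ∀ n → .{{NonZero n}} → ¬ (fromℕ n ≈ 0#)
  fromℕ-nonzero (suc n) = char0 n

  factorial-nonzero : ∀ n → ¬ (fromℕ (n !) ≈ 0#)
  factorial-nonzero n = fromℕ-nonzero (n !) {{n ℕP.!≢0}}

  inverse-cancelˡ : ∀ {x} y → ¬ (x ≈ 0#) → x ⁻¹ · (x · y) ≈ y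
  inverse-cancelˡ {x} y x≉0 = begin
    x ⁻¹ · (x · y)   ≈⟨ Mul.x∙yz≈yx∙z _ _ _ ⟩
    (x · x ⁻¹) · y   ≈⟨ *-cong (inverse x x≉0) refl ⟩
    1# · y           ≈⟨ *-identityˡ y ⟩
    y                ∎

  inverse-cancelʳ : ∀ {x} y → ¬ (x ≈ 0#) → x · (x ⁻¹ · y) ≈ y
  inverse-cancelʳ {x} y x≉0 = begin
    x · (x ⁻¹ · y)   ≈⟨ *-assoc _ _ _ ⟨
    (x · x ⁻¹) · y   ≈⟨ *-cong (inverse x x≉0) refl ⟩
    1# · y           ≈⟨ *-identityˡ y ⟩
    y                ∎

  inverse-of-one : ∀ {x} → x ≈ 1# → x ⁻¹ ≈ 1#
  inverse-of-one {x} x≈1 = begin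
    x ⁻¹        ≈⟨ *-identityˡ _ ⟨
    1# · x ⁻¹   ≈⟨ *-cong x≈1 refl ⟨
    x · x ⁻¹    ≈⟨ inverse x (λ x≈0 → 1≉0 (trans (sym x≈1) x≈0)) ⟩
    1#          ∎

  pow-nonzero : ∀ a k → ¬ (a ≈ 0#) → ¬ (a ^ k ≈ 0#)
  pow-nonzero a zero    a≉0 = 1≉0
  pow-nonzero a (suc k) a≉0 aᵏ⁺¹≈0 = pow-nonzero a k a≉0 (begin
    a ^ k                  ≈⟨ inverse-cancelˡ (a ^ k) a≉0 ⟨
    a ⁻¹ · (a · a ^ k)     ≈⟨ *-cong refl aᵏ⁺¹≈0 ⟩
    a ⁻¹ · 0#              ≈⟨ zeroʳ _ ⟩
    0#                     ∎)

  1-λ≉0 : ∀ {λ'} → ¬ (λ' ≈ 1#) → ¬ (1# - λ' ≈ 0#)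
  1-λ≉0 {λ'} λ≉1 1-λ≈0 = λ≉1 (begin
    λ'                ≈⟨ +-identityˡ _ ⟨
    0# + λ'           ≈⟨ +-cong 1-λ≈0 refl ⟨
    (1# - λ') + λ'    ≈⟨ +-assoc _ _ _ ⟩
    1# + (- λ' + λ')  ≈⟨ +-cong refl (-‿inverseˡ λ') ⟩
    1# + 0#           ≈⟨ +-identityʳ _ ⟩
    1#                ∎)

  I : ℕ → Carrier
  I k = fromℕ k ⁻¹

  -- C(n,i)/n! = 1/i! · 1/(n-i)!, the coefficient identity behind e^{xt}e^{yt} = e^{(x+y)t}

  binomial/factorial : ∀ {n i} → i ≤ n →
                       I (n !) · fromℕ (n C i) ≈ I (i !) · I ((n ∸ i) !)
  binomial/factorial {n} {i} i≤n = begin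
    I (n !) · fromℕ (n C i)             ≈⟨ *-cong refl n!·r≈C ⟨
    I (n !) · (fromℕ (n !) · r)         ≈⟨ inverse-cancelˡ r (factorial-nonzero n) ⟩
    r                                   ∎
    where
    A B r : Carrier
    A = fromℕ (i !)
    B = fromℕ ((n ∸ i) !)
    r = I (i !) · I ((n ∸ i) !)
    n!·r≈C : fromℕ (n !) · r ≈ fromℕ (n C i)
    n!·r≈C = begin
      fromℕ (n !) · r
        ≡⟨ Eq.cong (λ k → fromℕ k · r) (binomial-factorials i≤n) ⟨
      fromℕ ((n C i) * (i ! * (n ∸ i) !)) · r
        ≈⟨ *-cong (trans (fromℕ-* (n C i) _) (*-cong refl (fromℕ-* (i !) ((n ∸ i) !)))) refl ⟩
      (fromℕ (n C i) · (A · B)) · r            ≈⟨ *-assoc _ _ _ ⟩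
      fromℕ (n C i) · ((A · B) · r)            ≈⟨ *-cong refl (Mul.interchange A B _ _) ⟩
      fromℕ (n C i) · ((A · I (i !)) · (B · I ((n ∸ i) !)))
        ≈⟨ *-cong refl (*-cong (inverse A (factorial-nonzero i))
                               (inverse B (factorial-nonzero (n ∸ i)))) ⟩
      fromℕ (n C i) · (1# · 1#)                ≈⟨ *-cong refl (*-identityˡ 1#) ⟩
      fromℕ (n C i) · 1#                       ≈⟨ *-identityʳ _ ⟩
      fromℕ (n C i)                            ∎

  -- (2) Formal power series form a commutative semiring

  _≋_ : Series → Series → Set ℓ
  f ≋ g = ∀ n → f n ≈ g n

  _+ₛ_ : Series → Series → Series
  (f +ₛ g) n = f n + g n

  zeroS : Series
  zeroS _ = 0#

  constS : Carrier → Series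
  constS a = scale a oneS

  shift : Series → Series
  shift f k = f (suc k)

  -- The Cauchy product, computed by recursion on the degree:
  -- fg = f 0 · g + t · (shift f) g.  This form makes the semiring laws
  -- provable by induction.
  conv : Series → Series → Series
  conv f g zero    = f 0 · g 0
  conv f g (suc n) = f 0 · g (suc n) + conv (shift f) g n

  ⊛≈conv : ∀ f g n → (f ⊛ g) n ≈ conv f g n
  ⊛≈conv f g zero    = +-identityˡ _
  ⊛≈conv f g (suc n) = trans (sumℕ-uncons (suc n) _) (+-cong refl (⊛≈conv (shift f) g n))

  conv-cong : ∀ {f f' g g'} → f ≋ f' → g ≋ g' → conv f g ≋ conv f' g'
  conv-cong ef eg zero    = *-cong (ef 0) (eg 0)
  conv-cong ef eg (suc n) =
    +-cong (*-cong (ef 0) (eg (suc n))) (conv-cong (λ k → ef (suc k)) eg n)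

  conv-distribʳ : ∀ f g h n → conv (f +ₛ g) h n ≈ conv f h n + conv g h n
  conv-distribʳ f g h zero    = distribʳ _ _ _
  conv-distribʳ f g h (suc n) =
    trans (+-cong (distribʳ _ _ _) (conv-distribʳ (shift f) (shift g) h n))
          (Add.interchange _ _ _ _)

  conv-scaleˡ : ∀ a f g n → conv (scale a f) g n ≈ a · conv f g n
  conv-scaleˡ a f g zero    = *-assoc _ _ _
  conv-scaleˡ a f g (suc n) =
    trans (+-cong (*-assoc _ _ _) (conv-scaleˡ a (shift f) g n)) (sym (distribˡ _ _ _))

  conv-zeroˡ : ∀ g n → conv zeroS g n ≈ 0#
  conv-zeroˡ g zero    = zeroˡ _
  conv-zeroˡ g (suc n) = trans (+-cong (zeroˡ _) (conv-zeroˡ g n)) (+-identityˡ _)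

  conv-identityˡ : ∀ g n → conv oneS g n ≈ g n
  conv-identityˡ g zero    = *-identityˡ _
  conv-identityˡ g (suc n) = trans (+-cong (*-identityˡ _) (conv-zeroˡ g n)) (+-identityʳ _)

  conv-assoc : ∀ f g h n → conv (conv f g) h n ≈ conv f (conv g h) n
  conv-assoc f g h zero    = *-assoc _ _ _
  conv-assoc f g h (suc n) = begin
    (f 0 · g 0) · h (suc n) + conv (scale (f 0) (shift g) +ₛ conv (shift f) g) h n
      ≈⟨ +-cong (*-assoc _ _ _) (conv-distribʳ (scale (f 0) (shift g)) (conv (shift f) g) h n) ⟩
    f 0 · (g 0 · h (suc n)) + (conv (scale (f 0) (shift g)) h n + conv (conv (shift f) g) h n)
      ≈⟨ +-cong refl (+-cong (conv-scaleˡ (f 0) (shift g) h n) (conv-assoc (shift f) g h n)) ⟩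
    f 0 · (g 0 · h (suc n)) + (f 0 · conv (shift g) h n + conv (shift f) (conv g h) n)
      ≈⟨ +-assoc _ _ _ ⟨
    (f 0 · (g 0 · h (suc n)) + f 0 · conv (shift g) h n) + conv (shift f) (conv g h) n
      ≈⟨ +-cong (distribˡ _ _ _) refl ⟨
    f 0 · (g 0 · h (suc n) + conv (shift g) h n) + conv (shift f) (conv g h) n ∎

  conv-unconsʳ : ∀ n f g → conv f g (suc n) ≈ g 0 · f (suc n) + conv f (shift g) n
  conv-unconsʳ zero    f g = trans (+-comm _ _) (+-cong (*-comm _ _) refl)
  conv-unconsʳ (suc n) f g =
    trans (+-cong refl (conv-unconsʳ n (shift f) g)) (Add.x∙yz≈y∙xz _ _ _)

  conv-comm : ∀ f g n → conv f g n ≈ conv g f n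
  conv-comm f g zero    = *-comm _ _
  conv-comm f g (suc n) =
    trans (+-cong refl (conv-comm (shift f) g n)) (sym (conv-unconsʳ n g f))

  via-conv : ∀ {f g f' g'} → conv f g ≋ conv f' g' → (f ⊛ g) ≋ (f' ⊛ g')
  via-conv {f} {g} {f'} {g'} e n = trans (⊛≈conv f g n) (trans (e n) (sym (⊛≈conv f' g' n)))

  ⊛-cong : ∀ {f f' g g'} → f ≋ f' → g ≋ g' → (f ⊛ g) ≋ (f' ⊛ g')
  ⊛-cong ef eg = via-conv (conv-cong ef eg)

  ⊛-congˡ : ∀ f {g g'} → g ≋ g' → (f ⊛ g) ≋ (f ⊛ g')
  ⊛-congˡ f = ⊛-cong {f} {f} (λ _ → refl)

  ⊛-congʳ : ∀ h {f f'} → f ≋ f' → (f ⊛ h) ≋ (f' ⊛ h)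
  ⊛-congʳ h ef = ⊛-cong {g = h} {g' = h} ef (λ _ → refl)

  ⊛-assoc : ∀ f g h → ((f ⊛ g) ⊛ h) ≋ (f ⊛ (g ⊛ h))
  ⊛-assoc f g h = via-conv (λ n → begin
    conv (f ⊛ g) h n     ≈⟨ conv-cong (⊛≈conv f g) (λ _ → refl) n ⟩
    conv (conv f g) h n  ≈⟨ conv-assoc f g h n ⟩
    conv f (conv g h) n  ≈⟨ conv-cong (λ _ → refl) (λ k → sym (⊛≈conv g h k)) n ⟩
    conv f (g ⊛ h) n     ∎)

  ⊛-comm : ∀ f g → (f ⊛ g) ≋ (g ⊛ f)
  ⊛-comm f g = via-conv (conv-comm f g)

  ⊛-identityˡ : ∀ g → (oneS ⊛ g) ≋ g
  ⊛-identityˡ g n = trans (⊛≈conv oneS g n) (conv-identityˡ g n)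

  ⊛-zeroˡ : ∀ g → (zeroS ⊛ g) ≋ zeroS
  ⊛-zeroˡ g n = trans (⊛≈conv zeroS g n) (conv-zeroˡ g n)

  ⊛-distribʳ : ∀ h f g → ((f +ₛ g) ⊛ h) ≋ ((f ⊛ h) +ₛ (g ⊛ h))
  ⊛-distribʳ h f g n = trans (⊛≈conv _ h n)
    (trans (conv-distribʳ f g h n) (sym (+-cong (⊛≈conv f h n) (⊛≈conv g h n))))

  ⊛-scaleˡ : ∀ a f g → (scale a f ⊛ g) ≋ scale a (f ⊛ g)
  ⊛-scaleˡ a f g n =
    trans (⊛≈conv _ g n) (trans (conv-scaleˡ a f g n) (*-cong refl (sym (⊛≈conv f g n))))

  -- Series K is a commutative semiring, so the library's algebra applies to it
  ≋-isEquivalence : IsEquivalence _≋_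
  ≋-isEquivalence = record
    { refl = λ _ → refl ; sym = λ e n → sym (e n) ; trans = λ e e' n → trans (e n) (e' n) }

  open Algebra.Structures {A = Series} _≋_ using (IsCommutativeMonoid)

  +ₛ-isCommutativeMonoid : IsCommutativeMonoid _+ₛ_ zeroS
  +ₛ-isCommutativeMonoid = record
    { isMonoid = record
      { isSemigroup = record
        { isMagma = record
          { isEquivalence = ≋-isEquivalence ; ∙-cong = λ e e' n → +-cong (e n) (e' n) }
        ; assoc = λ _ _ _ _ → +-assoc _ _ _ }
      ; identity = (λ _ _ → +-identityˡ _) , (λ _ _ → +-identityʳ _) }
    ; comm = λ _ _ _ → +-comm _ _ }

  ⊛-isCommutativeMonoid : IsCommutativeMonoid _⊛_ oneS
  ⊛-isCommutativeMonoid = record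
    { isMonoid = record
      { isSemigroup = record
        { isMagma = record { isEquivalence = ≋-isEquivalence ; ∙-cong = ⊛-cong }
        ; assoc = ⊛-assoc }
      ; identity = ⊛-identityˡ , (λ g n → trans (⊛-comm g oneS n) (⊛-identityˡ g n)) }
    ; comm = ⊛-comm }

  seriesSemiring : CommutativeSemiring c ℓ
  seriesSemiring = record
    { Carrier = Series ; _≈_ = _≋_ ; _+_ = _+ₛ_ ; _*_ = _⊛_ ; 0# = zeroS ; 1# = oneS
    ; isCommutativeSemiring = Algebra.Structures.Biased.IsCommutativeSemiringˡ.isCommutativeSemiring
        (record
          { +-isCommutativeMonoid = +ₛ-isCommutativeMonoid
          ; *-isCommutativeMonoid = ⊛-isCommutativeMonoid
          ; distribʳ = ⊛-distribʳ
          ; zeroˡ = ⊛-zeroˡ }) }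

  module S = CommutativeSemiring seriesSemiring
  module SExp = Exp S.semiring
  module SMul = Mult S.semiring
  module SComm = CommSemigroupProperties S.*-commutativeSemigroup

  ⊛-scaleʳ : ∀ a f g → (f ⊛ scale a g) ≋ scale a (f ⊛ g)
  ⊛-scaleʳ a f g =
    S.trans (S.*-comm f _) (S.trans (⊛-scaleˡ a g f) (λ n → *-cong refl (S.*-comm g f n)))

  scale≈constS⊛ : ∀ a f → scale a f ≋ (constS a ⊛ f)
  scale≈constS⊛ a f = S.sym (S.trans (⊛-scaleˡ a oneS f) (λ n → *-cong refl (S.*-identityˡ f n)))

  powS≡^ : ∀ f n → powS f n ≡ f SExp.^ n
  powS≡^ f zero    = Eq.refl
  powS≡^ f (suc n) = Eq.cong (f ⊛_) (powS≡^ f n)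

  powS-cong : ∀ {f g} k → f ≋ g → powS f k ≋ powS g k
  powS-cong zero    e = S.refl
  powS-cong (suc k) e = ⊛-cong e (powS-cong k e)

  powS-+ : ∀ f a b → powS f (a ℕ.+ b) ≋ (powS f a ⊛ powS f b)
  powS-+ f a b rewrite powS≡^ f (a ℕ.+ b) | powS≡^ f a | powS≡^ f b = SExp.^-homo-* f a b

  powS-⊛ : ∀ f g k → powS (f ⊛ g) k ≋ (powS f k ⊛ powS g k)
  powS-⊛ f g k rewrite powS≡^ (f ⊛ g) k | powS≡^ f k | powS≡^ g k =
    CommExp.^-distrib-* seriesSemiring f g k

  powS-constS : ∀ a k → powS (constS a) k ≋ constS (a ^ k)
  powS-constS a zero    n = sym (*-identityˡ _)
  powS-constS a (suc k) = S.trans (⊛-congˡ (constS a) (powS-constS a k))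
    (S.trans (⊛-scaleˡ a oneS (constS (a ^ k)))
             (λ n → trans (*-cong refl (S.*-identityˡ (constS (a ^ k)) n)) (sym (*-assoc _ _ _))))

  sumₛ : ℕ → (ℕ → Series) → Series
  sumₛ k fs i = sumℕ k (λ l → fs l i)

  ⊛-sumₛ : ∀ q k fs → (q ⊛ sumₛ k fs) ≋ sumₛ k (λ l → q ⊛ fs l)
  ⊛-sumₛ q zero    fs = S.zeroʳ q
  ⊛-sumₛ q (suc k) fs i = trans (S.distribˡ q (sumₛ k fs) (fs k) i) (+-cong (⊛-sumₛ q k fs i) refl)

  -- (3) The binomial theorem in K and in the series semiring

  module KExp = Exp semiring
  module KSum = Sum semiring
  module SSum = Sum S.semiring

  ^≡^ : ∀ x n → x ^ n ≡ x KExp.^ n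
  ^≡^ x zero    = Eq.refl
  ^≡^ x (suc n) = Eq.cong (x ·_) (^≡^ x n)

  sum≈sumFin : ∀ n (f : Fin n → Carrier) → KSum.sum f ≈ sumFin n f
  sum≈sumFin zero    f = refl
  sum≈sumFin (suc n) f = +-cong refl (sum≈sumFin n (λ k → f (Fin.suc k)))

  binomial : ∀ x y n →
    (x + y) ^ n ≈ sumℕ (suc n) (λ i → fromℕ (n C i) · (x ^ i · y ^ (n ∸ i)))
  binomial x y n = begin
    (x + y) ^ n                       ≡⟨ ^≡^ (x + y) n ⟩
    (x + y) KExp.^ n                  ≈⟨ Binomial.theorem commutativeSemiring n x y ⟩
    KSum.sum {suc n} (λ k → term (toℕ k)) ≈⟨ sum≈sumFin (suc n) (λ k → term (toℕ k)) ⟩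
    sumFin (suc n) (λ k → term (toℕ k))
      ≈⟨ sumFin-cong (suc n) (λ k → trans (×≈fromℕ· (n C toℕ k) _)
                                          (*-cong refl (reflexive (monomial (toℕ k))))) ⟩
    sumFin (suc n) (λ k → fromℕ (n C toℕ k) · (x ^ toℕ k · y ^ (n ∸ toℕ k)))
      ≈⟨ sumFin≈sumℕ (suc n) (λ i → fromℕ (n C i) · (x ^ i · y ^ (n ∸ i))) ⟩
    sumℕ (suc n) (λ i → fromℕ (n C i) · (x ^ i · y ^ (n ∸ i))) ∎
    where
    term : ℕ → Carrier
    term i = (n C i) MulK.× (x KExp.^ i · y KExp.^ (n ∸ i))
    monomial : ∀ i → x KExp.^ i · y KExp.^ (n ∸ i) ≡ x ^ i · y ^ (n ∸ i)
    monomial i = Eq.sym (Eq.cong₂ _·_ (^≡^ x i) (^≡^ y (n ∸ i)))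

  binomialS : ∀ f g n →
    powS (f +ₛ g) n ≋ sumₛ (suc n) (λ l → scale (fromℕ (n C l)) (powS f l ⊛ powS g (n ∸ l)))
  binomialS f g n i = begin
    powS (f +ₛ g) n i                   ≡⟨ Eq.cong (λ s → s i) (powS≡^ (f +ₛ g) n) ⟩
    ((f +ₛ g) SExp.^ n) i               ≈⟨ Binomial.theorem seriesSemiring n f g i ⟩
    SSum.sum {suc n} (λ k → term (toℕ k)) i ≈⟨ coefficient (suc n) (λ k → term (toℕ k)) ⟩
    sumFin (suc n) (λ k → term (toℕ k) i)
      ≈⟨ sumFin-cong (suc n) (λ k → trans (×-coefficient (n C toℕ k) (monomialS (toℕ k)))
                                          (*-cong refl (reflexive (monomial (toℕ k))))) ⟩
    sumFin (suc n) (λ k → fromℕ (n C toℕ k) · (powS f (toℕ k) ⊛ powS g (n ∸ toℕ k)) i)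
      ≈⟨ sumFin≈sumℕ (suc n) (λ l → fromℕ (n C l) · (powS f l ⊛ powS g (n ∸ l)) i) ⟩
    sumₛ (suc n) (λ l → scale (fromℕ (n C l)) (powS f l ⊛ powS g (n ∸ l))) i ∎
    where
    monomialS : ℕ → Series
    monomialS l = (f SExp.^ l) ⊛ (g SExp.^ (n ∸ l))
    term : ℕ → Series
    term l = (n C l) SMul.× monomialS l
    coefficient : ∀ k (fs : Fin k → Series) → SSum.sum fs i ≈ sumFin k (λ j → fs j i)
    coefficient zero    fs = refl
    coefficient (suc k) fs = +-cong refl (coefficient k (λ j → fs (Fin.suc j)))
    ×-coefficient : ∀ k h → (k SMul.× h) i ≈ fromℕ k · h i
    ×-coefficient zero    h = sym (zeroˡ _)
    ×-coefficient (suc k) h =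
      trans (+-cong (sym (*-identityˡ _)) (×-coefficient k h)) (sym (distribʳ _ _ _))
    monomial : ∀ l → monomialS l i ≡ (powS f l ⊛ powS g (n ∸ l)) i
    monomial l = Eq.sym (Eq.cong₂ (λ s t → (s ⊛ t) i) (powS≡^ f l) (powS≡^ g (n ∸ l)))

  -- (4) The exponential series

  expS-+ : ∀ x y → (expS x ⊛ expS y) ≋ expS (x + y)
  expS-+ x y n = sym (begin
    (x + y) ^ n · I (n !)
      ≈⟨ *-comm _ _ ⟩
    I (n !) · (x + y) ^ n
      ≈⟨ *-cong refl (binomial x y n) ⟩
    I (n !) · sumℕ (suc n) (λ i → fromℕ (n C i) · (x ^ i · y ^ (n ∸ i)))
      ≈⟨ sumℕ-distribˡ (suc n) _ _ ⟩
    sumℕ (suc n) (λ i → I (n !) · (fromℕ (n C i) · (x ^ i · y ^ (n ∸ i))))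
      ≈⟨ sumℕ-cong< (suc n) (λ i i<1+n → term i (ℕP.≤-pred i<1+n)) ⟩
    sumℕ (suc n) (λ i → expS x i · expS y (n ∸ i)) ∎)
    where
    term : ∀ i → i ≤ n →
           I (n !) · (fromℕ (n C i) · (x ^ i · y ^ (n ∸ i))) ≈ expS x i · expS y (n ∸ i)
    term i i≤n = begin
      I (n !) · (fromℕ (n C i) · (x ^ i · y ^ (n ∸ i)))  ≈⟨ *-assoc _ _ _ ⟨
      (I (n !) · fromℕ (n C i)) · (x ^ i · y ^ (n ∸ i))  ≈⟨ *-cong (binomial/factorial i≤n) refl ⟩
      (I (i !) · I ((n ∸ i) !)) · (x ^ i · y ^ (n ∸ i))  ≈⟨ Mul.interchange _ _ _ _ ⟩
      (I (i !) · x ^ i) · (I ((n ∸ i) !) · y ^ (n ∸ i))  ≈⟨ *-cong (*-comm _ _) (*-comm _ _) ⟩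
      (x ^ i · I (i !)) · (y ^ (n ∸ i) · I ((n ∸ i) !))  ∎

  expS-zero : expS 0# ≋ oneS
  expS-zero zero    = trans (*-identityˡ _) (inverse-of-one (+-identityʳ 1#))
  expS-zero (suc n) = trans (*-cong (zeroˡ _) refl) (zeroˡ _)

  powS-expS : ∀ k → powS (expS 1#) k ≋ expS (fromℕ k)
  powS-expS zero    = S.sym expS-zero
  powS-expS (suc k) = S.trans (⊛-congˡ (expS 1#) (powS-expS k)) (expS-+ 1# (fromℕ k))

  -- (5) Inverse series

  lookup-invPrefix : ∀ f n (j : Fin (suc n)) → lookup (invPrefix f n) j ≡ invS f (n ∸ toℕ j)
  lookup-invPrefix f zero    Fin.zero    = Eq.refl
  lookup-invPrefix f (suc n) Fin.zero    = Eq.refl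
  lookup-invPrefix f (suc n) (Fin.suc j) = lookup-invPrefix f n j

  invS-inverse : ∀ f → ¬ (f 0 ≈ 0#) → (f ⊛ invS f) ≋ oneS
  invS-inverse f f0≉0 zero    = trans (⊛≈conv f (invS f) 0) (inverse (f 0) f0≉0)
  invS-inverse f f0≉0 (suc n) = begin
    (f ⊛ g) (suc n)                       ≈⟨ ⊛≈conv f g (suc n) ⟩
    f 0 · g (suc n) + conv (shift f) g n
      ≈⟨ +-cong (*-cong refl (*-cong refl recursion)) (sym (⊛≈conv (shift f) g n)) ⟩
    f 0 · (- (f 0 ⁻¹) · s) + s            ≈⟨ +-cong (*-cong refl (-‿distribˡ-* _ _)) refl ⟨
    f 0 · (- (f 0 ⁻¹ · s)) + s            ≈⟨ +-cong (-‿distribʳ-* _ _) refl ⟨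
    - (f 0 · (f 0 ⁻¹ · s)) + s            ≈⟨ +-cong (-‿cong (inverse-cancelʳ s f0≉0)) refl ⟩
    - s + s                               ≈⟨ -‿inverseˡ s ⟩
    0#                                    ∎
    where
    g : Series
    g = invS f
    s : Carrier
    s = sumℕ (suc n) (λ i → f (suc i) · g (n ∸ i))
    recursion : sumFin (suc n) (λ j → f (suc (toℕ j)) · lookup (invPrefix f n) j) ≈ s
    recursion = trans (sumFin-cong (suc n) (λ j → *-cong (refl {f (suc (toℕ j))})
                                                         (reflexive (lookup-invPrefix f n j))))
                      (sumFin≈sumℕ (suc n) (λ i → f (suc i) · g (n ∸ i)))

  -- (6) The generating-function identity and the theorem

  module _ (λ' : Carrier) where

    P : Series
    P = scale (1# - λ') (invS (expMinus λ'))

    coeff : ℕ → ℕ → Carrier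
    coeff m l = fromℕ (m C l) · ((- λ') ^ (m ∸ l))

    expMinus-split : expMinus λ' ≋ (expS 1# +ₛ constS (- λ'))
    expMinus-split zero    = +-cong refl (sym (*-identityʳ _))
    expMinus-split (suc i) = sym (trans (+-cong refl (zeroʳ _)) (+-identityʳ _))

    P-inverse : ¬ (λ' ≈ 1#) → (P ⊛ expMinus λ') ≋ constS (1# - λ')
    P-inverse λ≉1 = S.trans (⊛-scaleˡ (1# - λ') (invS M) M)
      (λ n → *-cong refl (S.trans (S.*-comm (invS M) M) (invS-inverse M M₀≉0) n))
      where
      M : Series
      M = expMinus λ'
      M₀≉0 : ¬ (M 0 ≈ 0#)
      M₀≉0 M₀≈0 = 1-λ≉0 λ≉1 (trans (sym (+-cong (expS-zero 0) refl)) M₀≈0)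

    shifted-exp-sum : ∀ x m →
      sumₛ (suc m) (λ l → scale (coeff m l) (expS (x + fromℕ l))) ≋ (expS x ⊛ powS (expMinus λ') m)
    shifted-exp-sum x m i = begin
      sumₛ (suc m) (λ l → scale (coeff m l) (expS (x + fromℕ l))) i
        ≈⟨ sumℕ-cong (suc m) (λ l → sym (summand l i)) ⟩
      sumₛ (suc m) (λ l → expS x ⊛ binomialTerm l) i
        ≈⟨ ⊛-sumₛ (expS x) (suc m) binomialTerm i ⟨
      (expS x ⊛ sumₛ (suc m) binomialTerm) i
        ≈⟨ ⊛-congˡ (expS x) (binomialS (expS 1#) (constS (- λ')) m) i ⟨
      (expS x ⊛ powS (expS 1# +ₛ constS (- λ')) m) i
        ≈⟨ ⊛-congˡ (expS x) (powS-cong m expMinus-split) i ⟨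
      (expS x ⊛ powS (expMinus λ') m) i ∎
      where
      powers : ℕ → Series
      powers l = powS (expS 1#) l ⊛ powS (constS (- λ')) (m ∸ l)
      binomialTerm : ℕ → Series
      binomialTerm l = scale (fromℕ (m C l)) (powers l)
      summand : ∀ l → (expS x ⊛ binomialTerm l) ≋ scale (coeff m l) (expS (x + fromℕ l))
      summand l i = begin
        (expS x ⊛ binomialTerm l) i
          ≈⟨ ⊛-scaleʳ binom (expS x) (powers l) i ⟩
        binom · (expS x ⊛ (powS (expS 1#) l ⊛ powS (constS (- λ')) (m ∸ l))) i
          ≈⟨ *-cong refl (⊛-congˡ (expS x) (⊛-cong (powS-expS l) (powS-constS (- λ') (m ∸ l))) i) ⟩
        binom · (expS x ⊛ (expS (fromℕ l) ⊛ constS μ)) i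
          ≈⟨ *-cong refl (S.trans (S.sym (S.*-assoc (expS x) (expS (fromℕ l)) (constS μ)))
                                      (⊛-congʳ (constS μ) (expS-+ x (fromℕ l))) i) ⟩
        binom · (expS (x + fromℕ l) ⊛ constS μ) i
          ≈⟨ *-cong refl (S.trans (S.*-comm (expS (x + fromℕ l)) (constS μ))
                                      (S.sym (scale≈constS⊛ μ (expS (x + fromℕ l)))) i) ⟩
        binom · (μ · expS (x + fromℕ l) i)
          ≈⟨ *-assoc _ _ _ ⟨
        coeff m l · expS (x + fromℕ l) i ∎
        where
        binom μ : Carrier
        binom = fromℕ (m C l)
        μ = (- λ') ^ (m ∸ l)

    FEgen-shift : ¬ (λ' ≈ 1#) → ∀ x n m →
      sumₛ (suc m) (λ l → scale (coeff m l) (FEgen (n ℕ.+ m) λ' (x + fromℕ l)))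
        ≋ scale ((1# - λ') ^ m) (FEgen n λ' x)
    FEgen-shift λ≉1 x n m i = begin
      sumₛ (suc m) (λ l → scale (coeff m l) (powS P (n ℕ.+ m) ⊛ shifted l)) i
        ≈⟨ sumℕ-cong (suc m) (λ l → sym (⊛-scaleʳ (coeff m l) (powS P (n ℕ.+ m)) (shifted l) i)) ⟩
      sumₛ (suc m) (λ l → powS P (n ℕ.+ m) ⊛ scale (coeff m l) (shifted l)) i
        ≈⟨ ⊛-sumₛ (powS P (n ℕ.+ m)) (suc m) (λ l → scale (coeff m l) (shifted l)) i ⟨
      (powS P (n ℕ.+ m) ⊛ sumₛ (suc m) (λ l → scale (coeff m l) (shifted l))) i
        ≈⟨ ⊛-cong (powS-+ P n m) (shifted-exp-sum x m) i ⟩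
      ((powS P n ⊛ powS P m) ⊛ (expS x ⊛ powS (expMinus λ') m)) i
        ≈⟨ SComm.interchange (powS P n) (powS P m) (expS x) (powS (expMinus λ') m) i ⟩
      ((powS P n ⊛ expS x) ⊛ (powS P m ⊛ powS (expMinus λ') m)) i
        ≈⟨ ⊛-congˡ (FEgen n λ' x) (powS-⊛ P (expMinus λ') m) i ⟨
      (FEgen n λ' x ⊛ powS (P ⊛ expMinus λ') m) i
        ≈⟨ ⊛-congˡ (FEgen n λ' x) (S.trans (powS-cong m (P-inverse λ≉1)) (powS-constS _ m)) i ⟩
      (FEgen n λ' x ⊛ constS ((1# - λ') ^ m)) i
        ≈⟨ S.trans (S.*-comm (FEgen n λ' x) _) (S.sym (scale≈constS⊛ _ (FEgen n λ' x))) i ⟩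
      (1# - λ') ^ m · FEgen n λ' x i ∎
      where
      shifted : ℕ → Series
      shifted l = expS (x + fromℕ l)

    H-shift : ¬ (λ' ≈ 1#) → ∀ x N n m →
      sumℕ (suc m) (λ l → coeff m l · H N (n ℕ.+ m) (x + fromℕ l) λ')
        ≈ (1# - λ') ^ m · H N n x λ'
    H-shift λ≉1 x N n m = begin
      sumℕ (suc m) (λ l → coeff m l · (N! · FEgen (n ℕ.+ m) λ' (x + fromℕ l) N))
        ≈⟨ sumℕ-cong (suc m) (λ l → Mul.x∙yz≈y∙xz _ _ _) ⟩
      sumℕ (suc m) (λ l → N! · (coeff m l · FEgen (n ℕ.+ m) λ' (x + fromℕ l) N))
        ≈⟨ sumℕ-distribˡ (suc m) N! _ ⟨
      N! · sumₛ (suc m) (λ l → scale (coeff m l) (FEgen (n ℕ.+ m) λ' (x + fromℕ l))) N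
        ≈⟨ *-cong refl (FEgen-shift λ≉1 x n m N) ⟩
      N! · ((1# - λ') ^ m · FEgen n λ' x N)
        ≈⟨ Mul.x∙yz≈y∙xz _ _ _ ⟩
      (1# - λ') ^ m · (N! · FEgen n λ' x N) ∎
      where
      N! : Carrier
      N! = fromℕ (N !)

-- With a = 1 + (a-1) we have a·n = n + m definitionally, where m = (a-1)n;
-- H-shift for N = n - 1 then gives the claim after cancelling (1-λ)^m.
theorem1 : {c ℓ : Level} (F : Char0Field c ℓ) →
  let open Char0Field F renaming (_*_ to _·_)
      open FrobeniusEuler F
  in (λ' x : Carrier) (a n : ℕ) → ¬ (λ' ≈ 1#) → 1 ≤ a → 1 ≤ n →
     H (n ∸ 1) n x λ'
       ≈ ((((1# - λ') ^ ((a ∸ 1) * n)) ⁻¹)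
           · sumℕ (suc ((a ∸ 1) * n))
               (λ l → (fromℕ (((a ∸ 1) * n) C l)
                        · ((- λ') ^ (((a ∸ 1) * n) ∸ l)))
                      · H (n ∸ 1) (a * n) (x + fromℕ l) λ'))
theorem1 F λ' x (suc a-1) n λ≉1 _ _ = sym (begin
  ((1# - λ') ^ m) ⁻¹ · sumℕ (suc m) (λ l → coeff λ' m l · H (n ∸ 1) (n ℕ.+ m) (x + fromℕ l) λ')
    ≈⟨ *-cong refl (H-shift λ' λ≉1 x (n ∸ 1) n m) ⟩
  ((1# - λ') ^ m) ⁻¹ · ((1# - λ') ^ m · H (n ∸ 1) n x λ')
    ≈⟨ inverse-cancelˡ _ (pow-nonzero _ m (1-λ≉0 λ≉1)) ⟩
  H (n ∸ 1) n x λ' ∎)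
  where
  open Char0Field F renaming (_*_ to _·_)
  open FrobeniusEuler F
  open Proof F
  open SetoidReasoning setoid
  m : ℕ
  m = a-1 * n
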